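{- Let $\mathcal{C} \subseteq \mathbb{F}_q^{k\times m}$ be a linear code, $A \in \mathrm{GL}_k(\mathbb{F}_q)$ and $1 \le u \le k-1$ an integer. Then $\Pi(\mathcal{C},A,u)^\perp = \Sigma(\mathcal{C}^\perp, (A^t)^{ -1}, u)$, where the dual on the left is taken in $\mathbb{F}_q^{(k-u)\times m}$.
   Context: $q$ is a prime power, $k\le m$ positive integers. A linear code is an $\mathbb{F}_q$-subspace of $\mathbb{F}_q^{a\times m}$; its dual is $\mathcal{C}^\perp = \{N : \mathrm{Tr}(MN^t) = 0 \text{ for all } M\in\mathcal{C}\}$. For a code $\mathcal{C}\subseteq\mathbb{F}_q^{k\times m}$ and $1\le u\le k-1$, $\mathcal{C}_u$ denotes the set of matrices in $\mathcal{C}$ whose first $u$ rows are zero; $A\mathcal{C} = \{AM : M\in\mathcal{C}\}$ for a $k\times k$ matrix $A$; $\pi_u:\mathbb{F}_q^{k\times m}\to\mathbb{F}_q^{(k-u)\times m}$ is the projection onto the last $k-u$ rows. The puncturing of $\mathcal{C}$ with respect to $A\in\mathrm{GL}_k(\mathbb{F}_q)$ and $u$ is $\Pi(\mathcal{C},A,u) = \pi_u(A\mathcal{C})$, and, when $0\in\mathcal{C}$, the shortening is $\Sigma(\mathcal{C},A,u) = \pi_u((A\mathcal{C})_u)$. -}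

module Defs where

open import Level using (Level; _⊔_)
open import Data.Nat using (ℕ; zero; suc; _∸_; _<_; _^_; _≤_; s≤s)
import Data.Nat as ℕ
open import Data.Nat.Primality using (Prime)
open import Data.Fin using (Fin; zero; suc; toℕ; fromℕ<)
open import Data.Fin.Properties using (toℕ<n)
open import Data.Product using (Σ; ∃; ∃-syntax; _×_; _,_)
open import Relation.Nullary using (¬_)
open import Relation.Binary.PropositionalEquality as ≡ using (_≡_)
open import Algebra.Bundles using (CommutativeRing)
open import Function.Bundles using (Inverse)

record Field (c ℓ : Level) : Set (Level.suc (c ⊔ ℓ)) where
  field
    commRing : CommutativeRing c ℓ
  open CommutativeRing commRing public
  field
    0≉1     : ¬ (0# ≈ 1#)
    inverse : ∀ x → ¬ (x ≈ 0#) → ∃[ y ] (x * y ≈ 1#)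

IsPrimePower : ℕ → Set
IsPrimePower q = ∃[ p ] ∃[ n ] (Prime p × 1 ≤ n × q ≡ p ^ n)

record FiniteField (c ℓ : Level) (q : ℕ) : Set (Level.suc (c ⊔ ℓ)) where
  field
    fld : Field c ℓ
  open Field fld public
  field
    enum : Inverse setoid (≡.setoid (Fin q))

module Matrices {c ℓ : Level} (F : Field c ℓ) where
  open Field F using (Carrier; _≈_; _+_; _*_; 0#; 1#)

  Mat : ℕ → ℕ → Set c
  Mat a b = Fin a → Fin b → Carrier

  ∑ : ∀ {n} → (Fin n → Carrier) → Carrier
  ∑ {zero}  f = 0#
  ∑ {suc n} f = f zero + ∑ (λ i → f (suc i))

  _≈ᴹ_ : ∀ {a b} → Mat a b → Mat a b → Set ℓ
  M ≈ᴹ N = ∀ i j → M i j ≈ N i j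

  0ᴹ : ∀ {a b} → Mat a b
  0ᴹ i j = 0#

  _+ᴹ_ : ∀ {a b} → Mat a b → Mat a b → Mat a b
  (M +ᴹ N) i j = M i j + N i j

  _·ᴹ_ : ∀ {a b} → Carrier → Mat a b → Mat a b
  (λ' ·ᴹ M) i j = λ' * M i j

  _⊗_ : ∀ {a b d} → Mat a b → Mat b d → Mat a d
  (M ⊗ N) i j = ∑ (λ l → M i l * N l j)

  transpose : ∀ {a b} → Mat a b → Mat b a
  transpose M i j = M j i

  I : ∀ {a} → Mat a a
  I {suc a} zero    zero    = 1#
  I {suc a} zero    (suc j) = 0#
  I {suc a} (suc i) zero    = 0#
  I {suc a} (suc i) (suc j) = I i j

  Tr : ∀ {a} → Mat a a → Carrier
  Tr M = ∑ (λ i → M i i)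

  IsInverseOf : ∀ {k} → Mat k k → Mat k k → Set ℓ
  IsInverseOf B A = ((A ⊗ B) ≈ᴹ I) × ((B ⊗ A) ≈ᴹ I)

  Invertible : ∀ {k} → Mat k k → Set (c ⊔ ℓ)
  Invertible A = ∃[ B ] IsInverseOf B A

  Code : ℕ → ℕ → Set (Level.suc (c ⊔ ℓ))
  Code a m = Mat a m → Set (c ⊔ ℓ)

  record IsLinear {a m} (C : Code a m) : Set (c ⊔ ℓ) where
    field
      respects : ∀ {M N} → M ≈ᴹ N → C M → C N
      has-0    : C 0ᴹ
      closed-+ : ∀ {M N} → C M → C N → C (M +ᴹ N)
      closed-· : ∀ λ' {M} → C M → C (λ' ·ᴹ M)

  _≐_ : ∀ {a m} → Code a m → Code a m → Set (c ⊔ ℓ)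
  C ≐ D = (∀ M → C M → D M) × (∀ M → D M → C M)

  Dual : ∀ {a m} → Code a m → Code a m
  Dual C N = ∀ M → C M → Tr (M ⊗ transpose N) ≈ 0#

  private
    lem : ∀ u k x → x < k ∸ u → u ℕ.+ x < k
    lem zero    k       x p = p
    lem (suc u) zero    x ()
    lem (suc u) (suc k) x p = s≤s (lem u k x p)

  shiftRow : ∀ {k} u → Fin (k ∸ u) → Fin k
  shiftRow {k} u i = fromℕ< (lem u k (toℕ i) (toℕ<n i))

  π : ∀ {k m} u → Mat k m → Mat (k ∸ u) m
  π u M i j = M (shiftRow u i) j

  FirstRowsZero : ∀ {k m} → ℕ → Mat k m → Set ℓ
  FirstRowsZero u M = ∀ i j → toℕ i < u → M i j ≈ 0#

  -- puncturing Π(C, A, u) = π_u(A C)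
  Puncture : ∀ {k m} → Code k m → Mat k k → (u : ℕ) → Code (k ∸ u) m
  Puncture C A u N = ∃[ M ] (C M × N ≈ᴹ π u (A ⊗ M))

  -- shortening Σ(C, A, u) = π_u((A C)_u)
  Shorten : ∀ {k m} → Code k m → Mat k k → (u : ℕ) → Code (k ∸ u) m
  Shorten C A u N =
    ∃[ M ] (C M × FirstRowsZero u (A ⊗ M) × N ≈ᴹ π u (A ⊗ M))

-- Write ⟪ M , N ⟫ = Tr (M Nᵗ) for the pairing defining duals. It satisfies
-- ⟪ A M , Y ⟫ = ⟪ M , Aᵗ Y ⟫, and when the first u rows of Y vanish only the
-- last k − u rows contribute: ⟪ X , Y ⟫ = ⟪ π X , π Y ⟫. Hence N is orthogonal
-- to π (A C) iff its zero-padding Ñ is orthogonal to A C, iff Aᵗ Ñ ∈ C^⊥; and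
-- since B = (Aᵗ)⁻¹ sends Aᵗ Ñ back to Ñ, the latter says exactly that N is the
-- projection of an element of B C^⊥ whose first u rows vanish.
module Submission where

open import Defs
open import Level using (Level)
open import Data.Nat using (ℕ; zero; suc; _≤_; _<_; _∸_; s≤s; z≤n)
open import Data.Fin using (Fin; zero; suc; toℕ)
open import Data.Fin.Properties using (fromℕ<-toℕ)
open import Data.Product using (_,_)
open import Function using (_∘_)
open import Relation.Binary.PropositionalEquality as ≡ using (_≡_)
import Algebra.Properties.Semiring.Sum as SemiringSum
import Relation.Binary.Reasoning.Setoid as SetoidReasoning

module MatrixAlgebra {c ℓ : Level} (F : Field c ℓ) where
  open Field F hiding (zero)
  open Matrices F
  open SemiringSum semiring using (sum; sum-cong-≋; sum-cong-≗; sum-replicate-zero; ∑-comm; *-distribˡ-sum; *-distribʳ-sum)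
  open SetoidReasoning setoid

  ∑≡sum : ∀ {n} (f : Fin n → Carrier) → ∑ f ≡ sum f
  ∑≡sum {zero}  f = ≡.refl
  ∑≡sum {suc n} f = ≡.cong (f zero +_) (∑≡sum (f ∘ suc))

  ∑-cong : ∀ {n} {f g : Fin n → Carrier} → (∀ i → f i ≈ g i) → ∑ f ≈ ∑ g
  ∑-cong {f = f} {g} f≈g = begin
    ∑ f   ≡⟨ ∑≡sum f ⟩
    sum f ≈⟨ sum-cong-≋ f≈g ⟩
    sum g ≡⟨ ∑≡sum g ⟨
    ∑ g   ∎

  ∑-zero : ∀ {n} {f : Fin n → Carrier} → (∀ i → f i ≈ 0#) → ∑ f ≈ 0#
  ∑-zero {n} {f} f≈0 = begin
    ∑ f                ≈⟨ ∑-cong f≈0 ⟩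
    ∑ {n} (λ _ → 0#)   ≡⟨ ∑≡sum {n} (λ _ → 0#) ⟩
    sum {n} (λ _ → 0#) ≈⟨ sum-replicate-zero n ⟩
    0#                 ∎

  ∑-swap : ∀ {n p} (f : Fin n → Fin p → Carrier) →
           ∑ (λ i → ∑ (f i)) ≈ ∑ (λ j → ∑ (λ i → f i j))
  ∑-swap f = begin
    ∑ (λ i → ∑ (f i))             ≡⟨ ∑≡sum (λ i → ∑ (f i)) ⟩
    sum (λ i → ∑ (f i))           ≡⟨ sum-cong-≗ (λ i → ∑≡sum (f i)) ⟩
    sum (λ i → sum (f i))         ≈⟨ ∑-comm f ⟩
    sum (λ j → sum (λ i → f i j)) ≡⟨ sum-cong-≗ (λ j → ∑≡sum (λ i → f i j)) ⟨
    sum (λ j → ∑ (λ i → f i j))   ≡⟨ ∑≡sum (λ j → ∑ (λ i → f i j)) ⟨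
    ∑ (λ j → ∑ (λ i → f i j))     ∎

  *-distribˡ-∑ : ∀ {n} x (f : Fin n → Carrier) → x * ∑ f ≈ ∑ (λ i → x * f i)
  *-distribˡ-∑ x f = begin
    x * ∑ f               ≡⟨ ≡.cong (x *_) (∑≡sum f) ⟩
    x * sum f             ≈⟨ *-distribˡ-sum x f ⟩
    sum (λ i → x * f i)   ≡⟨ ∑≡sum (λ i → x * f i) ⟨
    ∑ (λ i → x * f i)     ∎

  *-distribʳ-∑ : ∀ {n} x (f : Fin n → Carrier) → ∑ f * x ≈ ∑ (λ i → f i * x)
  *-distribʳ-∑ x f = begin
    ∑ f * x               ≡⟨ ≡.cong (_* x) (∑≡sum f) ⟩
    sum f * x             ≈⟨ *-distribʳ-sum x f ⟩
    sum (λ i → f i * x)   ≡⟨ ∑≡sum (λ i → f i * x) ⟨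
    ∑ (λ i → f i * x)     ∎

  ∑-I : ∀ {n} (i : Fin n) (f : Fin n → Carrier) → ∑ (λ l → I i l * f l) ≈ f i
  ∑-I {suc n} zero f = begin
    1# * f zero + ∑ (λ l → 0# * f (suc l)) ≈⟨ +-cong (*-identityˡ _) (∑-zero (λ l → zeroˡ (f (suc l)))) ⟩
    f zero + 0#                            ≈⟨ +-identityʳ _ ⟩
    f zero                                 ∎
  ∑-I {suc n} (suc i) f = begin
    0# * f zero + ∑ (λ l → I i l * f (suc l)) ≈⟨ +-cong (zeroˡ _) (∑-I i (f ∘ suc)) ⟩
    0# + f (suc i)                            ≈⟨ +-identityˡ _ ⟩
    f (suc i)                                 ∎

  I-⊗ : ∀ {a b} (X : Mat a b) → (I ⊗ X) ≈ᴹ X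
  I-⊗ X i j = ∑-I i (λ l → X l j)

  ⊗-congˡ : ∀ {a b d} {X X′ : Mat a b} (Y : Mat b d) → X ≈ᴹ X′ → (X ⊗ Y) ≈ᴹ (X′ ⊗ Y)
  ⊗-congˡ Y X≈X′ i j = ∑-cong (λ l → *-cong (X≈X′ i l) refl)

  ⊗-assoc : ∀ {a b d e} (X : Mat a b) (Y : Mat b d) (Z : Mat d e) →
            ((X ⊗ Y) ⊗ Z) ≈ᴹ (X ⊗ (Y ⊗ Z))
  ⊗-assoc X Y Z i j = begin
    ∑ (λ p → ∑ (λ l → X i l * Y l p) * Z p j)   ≈⟨ ∑-cong (λ p → *-distribʳ-∑ (Z p j) (λ l → X i l * Y l p)) ⟩
    ∑ (λ p → ∑ (λ l → X i l * Y l p * Z p j))   ≈⟨ ∑-cong (λ p → ∑-cong (λ l → *-assoc (X i l) (Y l p) (Z p j))) ⟩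
    ∑ (λ p → ∑ (λ l → X i l * (Y l p * Z p j))) ≈⟨ ∑-swap (λ l p → X i l * (Y l p * Z p j)) ⟨
    ∑ (λ l → ∑ (λ p → X i l * (Y l p * Z p j))) ≈⟨ ∑-cong (λ l → *-distribˡ-∑ (X i l) (λ p → Y l p * Z p j)) ⟨
    ∑ (λ l → X i l * ∑ (λ p → Y l p * Z p j))   ∎

  ⊗-cancelˡ : ∀ {a b} {B A : Mat a a} → (B ⊗ A) ≈ᴹ I → (X : Mat a b) → (B ⊗ (A ⊗ X)) ≈ᴹ X
  ⊗-cancelˡ {B = B} {A} BA≈I X i j = begin
    (B ⊗ (A ⊗ X)) i j ≈⟨ ⊗-assoc B A X i j ⟨
    ((B ⊗ A) ⊗ X) i j ≈⟨ ⊗-congˡ X BA≈I i j ⟩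
    (I ⊗ X) i j       ≈⟨ I-⊗ X i j ⟩
    X i j             ∎

  ⟪_,_⟫ : ∀ {a b} → Mat a b → Mat a b → Carrier
  ⟪ X , Y ⟫ = Tr (X ⊗ transpose Y)

  ⟪⟫-cong : ∀ {a b} {X X′ Y Y′ : Mat a b} → X ≈ᴹ X′ → Y ≈ᴹ Y′ → ⟪ X , Y ⟫ ≈ ⟪ X′ , Y′ ⟫
  ⟪⟫-cong X≈X′ Y≈Y′ = ∑-cong (λ i → ∑-cong (λ j → *-cong (X≈X′ i j) (Y≈Y′ i j)))

  ⟪⊗⟫-transpose : ∀ {k m} (A : Mat k k) (M Y : Mat k m) →
                  ⟪ A ⊗ M , Y ⟫ ≈ ⟪ M , transpose A ⊗ Y ⟫
  ⟪⊗⟫-transpose A M Y = begin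
    ∑ (λ i → ∑ (λ j → ∑ (λ l → A i l * M l j) * Y i j))
      ≈⟨ ∑-cong (λ i → ∑-cong (λ j → *-distribʳ-∑ (Y i j) (λ l → A i l * M l j))) ⟩
    ∑ (λ i → ∑ (λ j → ∑ (λ l → A i l * M l j * Y i j)))
      ≈⟨ ∑-cong (λ i → ∑-swap (λ j l → A i l * M l j * Y i j)) ⟩
    ∑ (λ i → ∑ (λ l → ∑ (λ j → A i l * M l j * Y i j)))
      ≈⟨ ∑-swap (λ i l → ∑ (λ j → A i l * M l j * Y i j)) ⟩
    ∑ (λ l → ∑ (λ i → ∑ (λ j → A i l * M l j * Y i j)))
      ≈⟨ ∑-cong (λ l → ∑-swap (λ i j → A i l * M l j * Y i j)) ⟩
    ∑ (λ l → ∑ (λ j → ∑ (λ i → A i l * M l j * Y i j)))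
      ≈⟨ ∑-cong (λ l → ∑-cong (λ j → ∑-cong (λ i → rearrange (A i l) (M l j) (Y i j)))) ⟩
    ∑ (λ l → ∑ (λ j → ∑ (λ i → M l j * (A i l * Y i j))))
      ≈⟨ ∑-cong (λ l → ∑-cong (λ j → *-distribˡ-∑ (M l j) (λ i → A i l * Y i j))) ⟨
    ∑ (λ l → ∑ (λ j → M l j * ∑ (λ i → A i l * Y i j)))
      ∎
    where
    rearrange : ∀ x y z → x * y * z ≈ y * (x * z)
    rearrange x y z = trans (*-cong (*-comm x y) refl) (*-assoc y x z)

  shiftRow-zero : ∀ {k} (i : Fin (k ∸ 0)) → shiftRow {k} 0 i ≡ i
  shiftRow-zero i = fromℕ<-toℕ i _

  ∑-shiftRow : ∀ {k} u (f : Fin k → Carrier) → (∀ i → toℕ i < u → f i ≈ 0#) →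
               ∑ f ≈ ∑ (f ∘ shiftRow u)
  ∑-shiftRow zero f _ = ∑-cong (λ i → reflexive (≡.cong f (≡.sym (shiftRow-zero i))))
  ∑-shiftRow {zero}  (suc u) f _ = refl
  ∑-shiftRow {suc k} (suc u) f f≈0 = begin
    f zero + ∑ (f ∘ suc)              ≈⟨ +-cong (f≈0 zero (s≤s z≤n)) tail-sum ⟩
    0# + ∑ (f ∘ suc ∘ shiftRow u)     ≈⟨ +-identityˡ _ ⟩
    ∑ (f ∘ suc ∘ shiftRow u)          ∎
    where
    tail-sum : ∑ (f ∘ suc) ≈ ∑ (f ∘ suc ∘ shiftRow u)
    tail-sum = ∑-shiftRow u (f ∘ suc) (λ i i<u → f≈0 (suc i) (s≤s i<u))

  ⟪⟫-π : ∀ {k m} u (X Y : Mat k m) → FirstRowsZero u Y → ⟪ X , Y ⟫ ≈ ⟪ π u X , π u Y ⟫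
  ⟪⟫-π u X Y Y₀ = ∑-shiftRow u _ (λ i i<u → ∑-zero (λ j → trans (*-cong refl (Y₀ i j i<u)) (zeroʳ _)))

  pad : ∀ {k m} u → Mat (k ∸ u) m → Mat k m
  pad zero N = N
  pad {suc k} (suc u) N zero    j = 0#
  pad {suc k} (suc u) N (suc i) j = pad {k} u N i j

  π-pad : ∀ {k m} u (N : Mat (k ∸ u) m) → π u (pad {k} u N) ≈ᴹ N
  π-pad zero N i j = reflexive (≡.cong (λ i′ → N i′ j) (shiftRow-zero i))
  π-pad {suc k} (suc u) N i j = π-pad {k} u N i j

  pad-FirstRowsZero : ∀ {k m} u (N : Mat (k ∸ u) m) → FirstRowsZero u (pad {k} u N)
  pad-FirstRowsZero {suc k} (suc u) N zero    j _         = refl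
  pad-FirstRowsZero {suc k} (suc u) N (suc i) j (s≤s i<u) = pad-FirstRowsZero {k} u N i j i<u

module _ {c ℓ : Level} (F : Field c ℓ) where
  open Field F using (setoid; 0#; refl; sym; trans)
  open Matrices F
  open MatrixAlgebra F
  open SetoidReasoning setoid

  Dual-Puncture⊆Shorten-Dual : ∀ {k m} (C : Code k m) (A B : Mat k k) u →
    (B ⊗ transpose A) ≈ᴹ I → ∀ N → Dual (Puncture C A u) N → Shorten (Dual C) B u N
  Dual-Puncture⊆Shorten-Dual {k} {m} C A B u BAᵗ≈I N N⊥ =
    transpose A ⊗ Ñ , Aᵗ⊗Ñ∈C⊥ , B⊗Aᵗ⊗Ñ-FirstRowsZero , N≈π
    where
    Ñ : Mat k m
    Ñ = pad u N

    Aᵗ⊗Ñ∈C⊥ : Dual C (transpose A ⊗ Ñ)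
    Aᵗ⊗Ñ∈C⊥ M M∈C = begin
      ⟪ M , transpose A ⊗ Ñ ⟫   ≈⟨ ⟪⊗⟫-transpose A M Ñ ⟨
      ⟪ A ⊗ M , Ñ ⟫             ≈⟨ ⟪⟫-π u (A ⊗ M) Ñ (pad-FirstRowsZero u N) ⟩
      ⟪ π u (A ⊗ M) , π u Ñ ⟫   ≈⟨ ⟪⟫-cong (λ _ _ → refl) (π-pad u N) ⟩
      ⟪ π u (A ⊗ M) , N ⟫       ≈⟨ N⊥ (π u (A ⊗ M)) (M , M∈C , λ _ _ → refl) ⟩
      0#                        ∎

    B⊗Aᵗ⊗Ñ≈Ñ : (B ⊗ (transpose A ⊗ Ñ)) ≈ᴹ Ñ
    B⊗Aᵗ⊗Ñ≈Ñ = ⊗-cancelˡ BAᵗ≈I Ñ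

    B⊗Aᵗ⊗Ñ-FirstRowsZero : FirstRowsZero u (B ⊗ (transpose A ⊗ Ñ))
    B⊗Aᵗ⊗Ñ-FirstRowsZero i j i<u = trans (B⊗Aᵗ⊗Ñ≈Ñ i j) (pad-FirstRowsZero u N i j i<u)

    N≈π : N ≈ᴹ π u (B ⊗ (transpose A ⊗ Ñ))
    N≈π i j = sym (trans (B⊗Aᵗ⊗Ñ≈Ñ (shiftRow u i) j) (π-pad u N i j))

  Shorten-Dual⊆Dual-Puncture : ∀ {k m} (C : Code k m) (A B : Mat k k) u →
    (transpose A ⊗ B) ≈ᴹ I → ∀ N → Shorten (Dual C) B u N → Dual (Puncture C A u) N
  Shorten-Dual⊆Dual-Puncture C A B u AᵗB≈I N (M′ , M′∈C⊥ , BM′₀ , N≈π) P (M , M∈C , P≈π) = begin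
    ⟪ P , N ⟫                               ≈⟨ ⟪⟫-cong P≈π N≈π ⟩
    ⟪ π u (A ⊗ M) , π u (B ⊗ M′) ⟫          ≈⟨ ⟪⟫-π u (A ⊗ M) (B ⊗ M′) BM′₀ ⟨
    ⟪ A ⊗ M , B ⊗ M′ ⟫                      ≈⟨ ⟪⊗⟫-transpose A M (B ⊗ M′) ⟩
    ⟪ M , transpose A ⊗ (B ⊗ M′) ⟫          ≈⟨ ⟪⟫-cong (λ _ _ → refl) (⊗-cancelˡ AᵗB≈I M′) ⟩
    ⟪ M , M′ ⟫                              ≈⟨ M′∈C⊥ M M∈C ⟩
    0#                                      ∎

-- Only B = (Aᵗ)⁻¹ is used: the identity holds for arbitrary codes, matrices and u.
theorem3p5 : {c ℓ : Level} (q : ℕ) → IsPrimePower q → (Fq : FiniteField c ℓ q) →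
    let open FiniteField Fq using (fld) in
    let open Matrices fld in
    (k m : ℕ) → k ≤ m →
    (C : Code k m) → IsLinear C →
    (A : Mat k k) → Invertible A →
    (B : Mat k k) → IsInverseOf B (transpose A) →
    (u : ℕ) → 1 ≤ u → u ≤ k ∸ 1 →
    Dual (Puncture C A u) ≐ Shorten (Dual C) B u
theorem3p5 q _ Fq k m _ C _ A _ B (AᵗB≈I , BAᵗ≈I) u _ _ =
  Dual-Puncture⊆Shorten-Dual fld C A B u BAᵗ≈I , Shorten-Dual⊆Dual-Puncture fld C A B u AᵗB≈I
  where open FiniteField Fq using (fld)
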